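{- Let $A$ be a directed bond-animal on the square lattice that contains a $k$-section (for a positive integer $k$). Then $A$ contains at least $2k-2$ vertical bonds. If $A$ contains a $k$-section and exactly $2k-2$ vertical bonds, then there are exactly $2$ vertical bonds in each row of $A$.
   Context: A bond-animal on the square lattice is a connected union of bonds (edges), up to translation; it is directed if some root vertex reaches every bond by a path in the animal of north and east steps only. A row is a horizontal strip between consecutive horizontal lattice lines $y=j$ and $y=j+1$; vertical bonds lie in rows. Section lines: for each row, draw a horizontal line through the middle of the lattice cells of that row from the extreme left (going right) and from the extreme right (going left); each such line is terminated when it first meets (is obstructed by) a vertical bond of the animal. Cut the lattice along each section line until it terminates at a vertical bond, then from that vertical bond cut vertically in both directions until another section line is reached; this splits the animal and lattice into pages. A section is the set of horizontal bonds of the animal within a single column of a given page (equivalently, the horizontal bonds of a column of the animal lying between two neighbouring section lines). A $k$-section is a section containing exactly $k$ horizontal bonds. -}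

module Defs where

open import Data.Nat using (ℕ; zero; suc)
open import Data.Integer using (ℤ; _+_; _<_; _≤_; _≟_; _<?_; _≤?_; 1ℤ)
open import Data.Product using (Σ; _×_; _,_)
open import Data.Sum using (_⊎_)
open import Data.List using (List; []; _∷_)
open import Data.List.Membership.Propositional using (_∈_)
open import Relation.Nullary using (¬_; does)
open import Relation.Binary.PropositionalEquality using (_≡_)
open import Data.Bool using (if_then_else_; _∧_)

data Dir : Set where
  H V : Dir

-- bond H x y : from (x , y) to (x + 1 , y)
-- bond V x y : from (x , y) to (x , y + 1)   (lies in row y, i.e. strip y ≤ Y ≤ y+1)
record Bond : Set where
  constructor bond
  field
    dir : Dir
    bx  : ℤ
    by  : ℤ
open Bond public

Vertex : Set
Vertex = ℤ × ℤ

start : Bond → Vertex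
start b = bx b , by b

end : Bond → Vertex
end (bond H x y) = x + 1ℤ , y
end (bond V x y) = x , y + 1ℤ

-- A (finite) set of bonds is represented by a duplicate-free list (see Statement).
-- Connectivity of the union of bonds: vertices linked through bonds of A.
data Linked (A : List Bond) (v : Vertex) : Vertex → Set where
  lrefl : Linked A v v
  lfwd  : ∀ b → b ∈ A → Linked A v (start b) → Linked A v (end b)
  lbwd  : ∀ b → b ∈ A → Linked A v (end b) → Linked A v (start b)

Connected : List Bond → Set
Connected A = ∀ b b′ → b ∈ A → b′ ∈ A → Linked A (start b) (start b′)

data NEReach (A : List Bond) (v : Vertex) : Vertex → Set where
  here : NEReach A v v
  step : ∀ b → b ∈ A → NEReach A v (start b) → NEReach A v (end b)

Directed : List Bond → Set
Directed A = Σ Vertex λ r → ∀ b → b ∈ A → NEReach A r (start b)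

countV : List Bond → ℕ
countV [] = zero
countV (bond H _ _ ∷ bs) = countV bs
countV (bond V _ _ ∷ bs) = suc (countV bs)

countVRow : ℤ → List Bond → ℕ
countVRow j [] = zero
countVRow j (bond H _ _ ∷ bs) = countVRow j bs
countVRow j (bond V _ y ∷ bs) =
  if does (y ≟ j) then suc (countVRow j bs) else countVRow j bs

-- number of horizontal bonds in column x (bonds (x,y)-(x+1,y)) with j₁ < y ≤ j₂,
-- i.e. lying strictly between the section lines of rows j₁ and j₂ (heights j+1/2)
countHCol : ℤ → ℤ → ℤ → List Bond → ℕ
countHCol x j₁ j₂ [] = zero
countHCol x j₁ j₂ (bond V _ _ ∷ bs) = countHCol x j₁ j₂ bs
countHCol x j₁ j₂ (bond H x′ y ∷ bs) =
  if does (x′ ≟ x) ∧ does (j₁ <? y) ∧ does (y ≤? j₂)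
  then suc (countHCol x j₁ j₂ bs) else countHCol x j₁ j₂ bs

-- The section line of row j (at height j + 1/2) passes through the cell of
-- column x (strip x ≤ X ≤ x+1): either the line coming from the left reaches it
-- (every vertical bond of row j lies at abscissa > x), or the line coming
-- from the right reaches it (every vertical bond of row j lies at abscissa ≤ x).
Crosses : List Bond → ℤ → ℤ → Set
Crosses A j x =
  (∀ b → b ∈ A → dir b ≡ V → by b ≡ j → x < bx b) ⊎
  (∀ b → b ∈ A → dir b ≡ V → by b ≡ j → bx b ≤ x)

-- A k-section: the horizontal bonds of column x lying between two
-- neighbouring section lines (of rows j₁ < j₂) crossing that column, k in number.
HasSection : List Bond → ℕ → Set
HasSection A k =
  Σ ℤ λ x → Σ ℤ λ j₁ → Σ ℤ λ j₂ →
    (j₁ < j₂) × Crosses A j₁ x × Crosses A j₂ x ×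
    (∀ j → j₁ < j → j < j₂ → ¬ Crosses A j x) ×
    (countHCol x j₁ j₂ A ≡ k)

SpansRow : List Bond → ℤ → Set
SpansRow A j =
  (Σ Bond λ b → b ∈ A × by b ≤ j) × (Σ Bond λ b → b ∈ A × (j + 1ℤ ≤ Data.Product.proj₂ (end b)))

-- Let the k-section lie in column x between the section lines of rows j₁ and
-- j₁ + m + 1. Its k horizontal bonds are distinct bonds of that column at the
-- heights j₁ + 1, …, j₁ + m + 1, so k ≤ m + 1. No section line reaches column x
-- in the m rows in between, so each of them has a vertical bond on either side
-- of the column, giving at least 2m ≥ 2k − 2 vertical bonds. In the equality
-- case these m rows carry all vertical bonds, two each, while connectivity puts a
-- vertical bond in every row the animal meets; so every such row is one of them.

module Submission where

open import Defs
open import Data.Nat using (ℕ; _*_; _∸_; _≤_)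
open import Data.Integer using (ℤ)
open import Data.Product using (_×_)
open import Data.List using (List)
open import Data.List.Relation.Unary.Unique.Propositional using (Unique)
open import Relation.Binary.PropositionalEquality using (_≡_)

open import Level using (Level; 0ℓ)
open import Data.Bool using (true; false; _∧_)
open import Data.Nat using (zero; suc; _+_; _<_; z≤n; s≤s)
import Data.Nat.Properties as ℕ
open import Data.Integer using (+_; +<+; 1ℤ; _-_; ∣_∣; _<?_; _≤?_; _≟_)
  renaming (_+_ to _+ℤ_; _<_ to _<ℤ_; _≤_ to _≤ℤ_; suc to sucℤ)
import Data.Integer.Properties as ℤ
open import Data.Integer.Tactic.RingSolver using (solve-∀)
open import Data.List using ([]; _∷_; length; filter)
open import Data.List.Properties using (filter-none)
open import Data.List.Membership.Propositional using (_∈_; find; lose)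
open import Data.List.Membership.Propositional.Properties using (∈-filter⁺; ∈-length)
open import Data.List.Relation.Unary.Any using (here; there; any?)
open import Data.List.Relation.Unary.All as All using (All)
open import Data.List.Relation.Unary.AllPairs using (_∷_)
import Data.List.Relation.Binary.Sublist.Propositional as Sublist
import Data.List.Relation.Binary.Sublist.Propositional.Properties as Sublist
open import Data.Product using (∃; _,_; proj₁; proj₂)
open import Data.Sum using (_⊎_; inj₁; inj₂; [_,_]′)
open import Data.Empty using (⊥-elim)
open import Relation.Nullary using (¬_; yes; no; does; _×-dec_)
open import Relation.Unary using (Pred; Decidable; _⊆_; _≐_; _∪_; _⊥_)
open import Relation.Unary.Properties using (_∪?_)
open import Function using (_∘_)
open import Relation.Binary using (DecidableEquality; tri<; tri≈; tri>)
open import Relation.Binary.PropositionalEquality using (_≢_; refl; sym; trans; cong; cong₂; subst; module ≡-Reasoning)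

private variable
  a p q : Level
  X : Set a

count : {P : Pred X p} → Decidable P → List X → ℕ
count P? xs = length (filter P? xs)

∈-length₂ : ∀ {x y : X} {xs} → x ∈ xs → y ∈ xs → x ≢ y → 2 ≤ length xs
∈-length₂ (here refl) (here refl) x≢y = ⊥-elim (x≢y refl)
∈-length₂ (here refl) (there y∈xs) _   = s≤s (∈-length y∈xs)
∈-length₂ (there x∈xs) (here refl) _   = s≤s (∈-length x∈xs)
∈-length₂ (there x∈xs) (there y∈xs) x≢y = ℕ.m≤n⇒m≤1+n (∈-length₂ x∈xs y∈xs x≢y)

module _ {P : Pred X p} (P? : Decidable P) where

  count-none : ∀ xs → All (¬_ ∘ P) xs → count P? xs ≡ 0
  count-none xs none = cong length (filter-none P? none)

  count-≥1 : ∀ {x xs} → x ∈ xs → P x → 1 ≤ count P? xs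
  count-≥1 x∈xs px = ∈-length (∈-filter⁺ P? x∈xs px)

  count-≥2 : ∀ {x y xs} → x ∈ xs → y ∈ xs → x ≢ y → P x → P y → 2 ≤ count P? xs
  count-≥2 x∈xs y∈xs x≢y px py = ∈-length₂ (∈-filter⁺ P? x∈xs px) (∈-filter⁺ P? y∈xs py) x≢y

  count-≤1 : (∀ {x y} → P x → P y → x ≡ y) → ∀ {xs} → Unique xs → count P? xs ≤ 1
  count-≤1 P-unique {[]} _ = z≤n
  count-≤1 P-unique {x ∷ xs} (x∉xs ∷ unique) with P? x
  ... | no _   = count-≤1 P-unique unique
  ... | yes px = ℕ.≤-reflexive (cong suc (count-none xs (All.map (λ x≢y py → x≢y (P-unique px py)) x∉xs)))

count-mono : {P : Pred X p} {Q : Pred X q} (P? : Decidable P) (Q? : Decidable Q) →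
             P ⊆ Q → ∀ xs → count P? xs ≤ count Q? xs
count-mono P? Q? P⊆Q xs =
  Sublist.length-mono-≤ (Sublist.filter⁺ P? Q? (λ { refl → P⊆Q }) (Sublist.⊆-refl {x = xs}))

count-cong : {P : Pred X p} {Q : Pred X q} (P? : Decidable P) (Q? : Decidable Q) →
             P ≐ Q → ∀ xs → count P? xs ≡ count Q? xs
count-cong P? Q? (P⊆Q , Q⊆P) xs = ℕ.≤-antisym (count-mono P? Q? P⊆Q xs) (count-mono Q? P? Q⊆P xs)

count-∪ : {P : Pred X p} {Q : Pred X q} (P? : Decidable P) (Q? : Decidable Q) →
          P ⊥ Q → ∀ xs → count (P? ∪? Q?) xs ≡ count P? xs + count Q? xs
count-∪ P? Q? P⊥Q [] = refl
count-∪ P? Q? P⊥Q (x ∷ xs) with P? x | Q? x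
... | yes px | yes qx = ⊥-elim (P⊥Q (px , qx))
... | yes _  | no _   = cong suc (count-∪ P? Q? P⊥Q xs)
... | no _   | yes _  = trans (cong suc (count-∪ P? Q? P⊥Q xs)) (sym (ℕ.+-suc _ _))
... | no _   | no _   = count-∪ P? Q? P⊥Q xs

∑< : ℕ → (ℕ → ℕ) → ℕ
∑< zero    f = 0
∑< (suc n) f = f n + ∑< n f

syntax ∑< n (λ i → e) = ∑[ i < n ] e

∑-const : ∀ n c → ∑[ i < n ] c ≡ n * c
∑-const zero    c = refl
∑-const (suc n) c = cong (λ s → c + s) (∑-const n c)

∑-cong : ∀ n {f g : ℕ → ℕ} → (∀ i → f i ≡ g i) → ∑< n f ≡ ∑< n g
∑-cong zero    f≡g = refl
∑-cong (suc n) f≡g = cong₂ _+_ (f≡g n) (∑-cong n f≡g)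

∑-mono-≤ : ∀ n {f g : ℕ → ℕ} → (∀ {i} → i < n → f i ≤ g i) → ∑< n f ≤ ∑< n g
∑-mono-≤ zero    f≤g = z≤n
∑-mono-≤ (suc n) f≤g = ℕ.+-mono-≤ (f≤g ℕ.≤-refl) (∑-mono-≤ n (λ i<n → f≤g (ℕ.m<n⇒m<1+n i<n)))

∑-mono-≤-tight : ∀ n {f g : ℕ → ℕ} → (∀ {i} → i < n → f i ≤ g i) → ∑< n g ≤ ∑< n f →
                 ∀ {i} → i < n → f i ≡ g i
∑-mono-≤-tight (suc n) {f} {g} f≤g ∑g≤∑f {i} i<1+n with ℕ.m≤n⇒m<n∨m≡n (ℕ.≤-pred i<1+n)
... | inj₁ i<n  = ∑-mono-≤-tight n (λ j<n → f≤g (ℕ.m<n⇒m<1+n j<n)) ∑g≤∑f-below i<n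
  where
    ∑g≤∑f-below : ∑< n g ≤ ∑< n f
    ∑g≤∑f-below = ℕ.+-cancelˡ-≤ (g n) _ _
      (ℕ.≤-trans ∑g≤∑f (ℕ.+-monoˡ-≤ (∑< n f) (f≤g ℕ.≤-refl)))
... | inj₂ refl = ℕ.≤-antisym (f≤g ℕ.≤-refl) (ℕ.+-cancelʳ-≤ (∑< n g) _ _
      (ℕ.≤-trans ∑g≤∑f (ℕ.+-monoʳ-≤ (f n) (∑-mono-≤ n (λ j<n → f≤g (ℕ.m<n⇒m<1+n j<n))))))

private variable
  i j : ℤ

i<j⇒j≡i+suc : i <ℤ j → ∃ λ n → j ≡ i +ℤ + suc n
i<j⇒j≡i+suc {i} {j} i<j = ∣ j - sucℤ i ∣ , (begin
  j                            ≡⟨ sym (rearrange i j) ⟩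
  i +ℤ (1ℤ +ℤ (j - sucℤ i))    ≡⟨ cong (λ d → i +ℤ (1ℤ +ℤ d)) (sym (ℤ.0≤i⇒+∣i∣≡i 0≤j-1-i)) ⟩
  i +ℤ + suc ∣ j - sucℤ i ∣    ∎)
  where
    open ≡-Reasoning
    rearrange : ∀ i j → i +ℤ (1ℤ +ℤ (j - (1ℤ +ℤ i))) ≡ j
    rearrange = solve-∀
    0≤j-1-i : + 0 ≤ℤ j - sucℤ i
    0≤j-1-i = ℤ.i≤j⇒0≤j-i (ℤ.i<j⇒suc[i]≤j i<j)

+-suc : ∀ i n → i +ℤ + suc n ≡ sucℤ (i +ℤ + n)
+-suc i n = shift i (+ n)
  where
    shift : ∀ i d → i +ℤ (1ℤ +ℤ d) ≡ 1ℤ +ℤ (i +ℤ d)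
    shift = solve-∀

i<i+suc : ∀ i n → i <ℤ i +ℤ + suc n
i<i+suc i n rewrite +-suc i n = ℤ.suc[i]≤j⇒i<j (ℤ.suc-mono (ℤ.i≤i+j i (+ n)))

≤suc⇒≡∨≤ : i ≤ℤ sucℤ j → i ≡ sucℤ j ⊎ i ≤ℤ j
≤suc⇒≡∨≤ {i} {j} i≤1+j with i ≟ sucℤ j
... | yes i≡1+j = inj₁ i≡1+j
... | no  i≢1+j = inj₂ (subst (i ≤ℤ_) (ℤ.pred-suc j) (ℤ.i<j⇒i≤pred[j] (ℤ.≤∧≢⇒< i≤1+j i≢1+j)))

i+n<i+suc : ∀ i n → i +ℤ + n <ℤ i +ℤ + suc n
i+n<i+suc i n = ℤ.+-monoʳ-< i (+<+ ℕ.≤-refl)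

in-band⇒≡+suc : ∀ n → i <ℤ j → j ≤ℤ i +ℤ + n → ∃ λ k → k < n × j ≡ i +ℤ + suc k
in-band⇒≡+suc {i} {j} zero i<j j≤i =
  ⊥-elim (ℤ.<-irrefl refl (ℤ.<-≤-trans i<j (subst (j ≤ℤ_) (ℤ.+-identityʳ i) j≤i)))
in-band⇒≡+suc {i} {j} (suc n) i<j j≤i+1+n with ≤suc⇒≡∨≤ (subst (j ≤ℤ_) (+-suc i n) j≤i+1+n)
... | inj₁ j≡1+i+n = n , ℕ.≤-refl , trans j≡1+i+n (sym (+-suc i n))
... | inj₂ j≤i+n   = let k , k<n , j≡ = in-band⇒≡+suc n i<j j≤i+n in k , ℕ.m<n⇒m<1+n k<n , j≡

module _ (height : X → ℤ) {P : Pred X p} (P? : Decidable P) where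

  AtHeight : ℤ → Pred X p
  AtHeight j x = P x × height x ≡ j

  atHeight? : ∀ j → Decidable (AtHeight j)
  atHeight? j x = P? x ×-dec (height x ≟ j)

  InBand : ℤ → ℤ → Pred X p
  InBand j₁ j₂ x = P x × j₁ <ℤ height x × height x ≤ℤ j₂

  inBand? : ∀ j₁ j₂ → Decidable (InBand j₁ j₂)
  inBand? j₁ j₂ x = P? x ×-dec (j₁ <? height x ×-dec height x ≤? j₂)

  count-InBand : ∀ j n xs → count (inBand? j (j +ℤ + n)) xs ≡ ∑[ i < n ] count (atHeight? (j +ℤ + suc i)) xs
  count-InBand j zero    xs = count-none (inBand? j (j +ℤ + 0)) xs (All.tabulate λ _ → empty-band)
    where
      empty-band : ∀ {x} → ¬ InBand j (j +ℤ + 0) x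
      empty-band (_ , j<h , h≤j) with in-band⇒≡+suc 0 j<h h≤j
      ... | _ , () , _
  count-InBand j (suc n) xs = begin
    count (inBand? j (j +ℤ + suc n)) xs
      ≡⟨ count-cong (inBand? j _) (atHeight? _ ∪? inBand? j _) (top-row-split , top-row-merge) xs ⟩
    count (atHeight? (j +ℤ + suc n) ∪? inBand? j (j +ℤ + n)) xs
      ≡⟨ count-∪ (atHeight? _) (inBand? j _) top-row-disjoint xs ⟩
    count (atHeight? (j +ℤ + suc n)) xs + count (inBand? j (j +ℤ + n)) xs
      ≡⟨ cong (λ c → count (atHeight? (j +ℤ + suc n)) xs + c) (count-InBand j n xs) ⟩
    ∑[ i < suc n ] count (atHeight? (j +ℤ + suc i)) xs ∎
    where
      open ≡-Reasoning
      top-row-split : InBand j (j +ℤ + suc n) ⊆ AtHeight (j +ℤ + suc n) ∪ InBand j (j +ℤ + n)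
      top-row-split (px , j<h , h≤j+1+n) with ≤suc⇒≡∨≤ (subst (_ ≤ℤ_) (+-suc j n) h≤j+1+n)
      ... | inj₁ h≡1+j+n = inj₁ (px , trans h≡1+j+n (sym (+-suc j n)))
      ... | inj₂ h≤j+n   = inj₂ (px , j<h , h≤j+n)
      top-row-merge : AtHeight (j +ℤ + suc n) ∪ InBand j (j +ℤ + n) ⊆ InBand j (j +ℤ + suc n)
      top-row-merge (inj₁ (px , h≡j+1+n)) =
        px , subst (j <ℤ_) (sym h≡j+1+n) (i<i+suc j n) , ℤ.≤-reflexive h≡j+1+n
      top-row-merge (inj₂ (px , j<h , h≤j+n)) = px , j<h , ℤ.≤-trans h≤j+n (ℤ.<⇒≤ (i+n<i+suc j n))
      top-row-disjoint : AtHeight (j +ℤ + suc n) ⊥ InBand j (j +ℤ + n)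
      top-row-disjoint ((_ , h≡j+1+n) , (_ , _ , h≤j+n)) =
        ℤ.<-irrefl refl (ℤ.<-≤-trans (i+n<i+suc j n) (subst (_≤ℤ _) h≡j+1+n h≤j+n))

_≟ᵈ_ : DecidableEquality Dir
H ≟ᵈ H = yes refl
H ≟ᵈ V = no λ ()
V ≟ᵈ H = no λ ()
V ≟ᵈ V = yes refl

Vertical : Pred Bond 0ℓ
Vertical b = dir b ≡ V

vertical? : Decidable Vertical
vertical? b = dir b ≟ᵈ V

HorizontalAt : ℤ → Pred Bond 0ℓ
HorizontalAt x b = dir b ≡ H × bx b ≡ x

horizontalAt? : ∀ x → Decidable (HorizontalAt x)
horizontalAt? x b = (dir b ≟ᵈ H) ×-dec (bx b ≟ x)

VerticalIn : ℤ → Pred Bond 0ℓ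
VerticalIn = AtHeight by vertical?

verticalIn? : ∀ j → Decidable (VerticalIn j)
verticalIn? = atHeight? by vertical?

countV≡count : ∀ A → countV A ≡ count vertical? A
countV≡count []                = refl
countV≡count (bond H _ _ ∷ A) = countV≡count A
countV≡count (bond V _ _ ∷ A) = cong suc (countV≡count A)

countVRow≡count : ∀ j A → countVRow j A ≡ count (verticalIn? j) A
countVRow≡count j []                = refl
countVRow≡count j (bond H _ _ ∷ A) = countVRow≡count j A
countVRow≡count j (bond V _ y ∷ A) with does (y ≟ j)
... | true  = cong suc (countVRow≡count j A)
... | false = countVRow≡count j A

countHCol≡count : ∀ x j₁ j₂ A → countHCol x j₁ j₂ A ≡ count (inBand? by (horizontalAt? x) j₁ j₂) A
countHCol≡count x j₁ j₂ []                 = refl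
countHCol≡count x j₁ j₂ (bond V _ _ ∷ A)  = countHCol≡count x j₁ j₂ A
countHCol≡count x j₁ j₂ (bond H x′ y ∷ A) with does (x′ ≟ x) ∧ does (j₁ <? y) ∧ does (y ≤? j₂)
... | true  = cong suc (countHCol≡count x j₁ j₂ A)
... | false = countHCol≡count x j₁ j₂ A

HorizontalAt-unique : ∀ {x y b b′} →
  AtHeight by (horizontalAt? x) y b → AtHeight by (horizontalAt? x) y b′ → b ≡ b′
HorizontalAt-unique {b = bond H _ _} {bond H _ _} ((refl , refl) , refl) ((refl , refl) , refl) = refl

countHCol≤ : ∀ x j n {A} → Unique A → countHCol x j (j +ℤ + n) A ≤ n
countHCol≤ x j n {A} unique = begin
  countHCol x j (j +ℤ + n) A
    ≡⟨ countHCol≡count x j _ A ⟩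
  count (inBand? by (horizontalAt? x) j (j +ℤ + n)) A
    ≡⟨ count-InBand by (horizontalAt? x) j n A ⟩
  ∑[ i < n ] count (atHeight? by (horizontalAt? x) (j +ℤ + suc i)) A
    ≤⟨ ∑-mono-≤ n (λ _ → count-≤1 (atHeight? by (horizontalAt? x) _) HorizontalAt-unique unique) ⟩
  ∑[ i < n ] 1
    ≡⟨ ∑-const n 1 ⟩
  n * 1
    ≡⟨ ℕ.*-identityʳ n ⟩
  n ∎
  where open ℕ.≤-Reasoning

∑countVRow≡count : ∀ j n A →
  ∑[ i < n ] countVRow (j +ℤ + suc i) A ≡ count (inBand? by vertical? j (j +ℤ + n)) A
∑countVRow≡count j n A =
  trans (∑-cong n (λ i → countVRow≡count (j +ℤ + suc i) A)) (sym (count-InBand by vertical? j n A))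

∑countVRow≤countV : ∀ j n A → ∑[ i < n ] countVRow (j +ℤ + suc i) A ≤ countV A
∑countVRow≤countV j n A = begin
  ∑[ i < n ] countVRow (j +ℤ + suc i) A       ≡⟨ ∑countVRow≡count j n A ⟩
  count (inBand? by vertical? j (j +ℤ + n)) A ≤⟨ count-mono (inBand? by vertical? j _) vertical? proj₁ A ⟩
  count vertical? A                           ≡⟨ sym (countV≡count A) ⟩
  countV A                                    ∎
  where open ℕ.≤-Reasoning

∑countVRow+countVRow≤countV : ∀ j n {j′} A → ¬ (j <ℤ j′ × j′ ≤ℤ j +ℤ + n) →
                              ∑[ i < n ] countVRow (j +ℤ + suc i) A + countVRow j′ A ≤ countV A
∑countVRow+countVRow≤countV j n {j′} A j′∉band = begin
  ∑[ i < n ] countVRow (j +ℤ + suc i) A + countVRow j′ A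
    ≡⟨ cong₂ _+_ (∑countVRow≡count j n A) (countVRow≡count j′ A) ⟩
  count band? A + count (verticalIn? j′) A
    ≡⟨ sym (count-∪ band? (verticalIn? j′) (λ { ((_ , in-band) , (_ , refl)) → j′∉band in-band }) A) ⟩
  count (band? ∪? verticalIn? j′) A
    ≤⟨ count-mono (band? ∪? verticalIn? j′) vertical? [ proj₁ , proj₁ ]′ A ⟩
  count vertical? A
    ≡⟨ countV≡count A ⟨
  countV A ∎
  where
    open ℕ.≤-Reasoning
    band? : Decidable (InBand by vertical? j (j +ℤ + n))
    band? = inBand? by vertical? j (j +ℤ + n)

¬Crosses⇒2≤countVRow : ∀ {A j x} → ¬ Crosses A j x → 2 ≤ countVRow j A
¬Crosses⇒2≤countVRow {A} {j} {x} ¬crosses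
  with any? (λ b → verticalIn? j b ×-dec (bx b ≤? x)) A | any? (λ b → verticalIn? j b ×-dec (x <? bx b)) A
... | no ¬left | _ = ⊥-elim (¬crosses (inj₁ λ b b∈A vertical in-row →
        ℤ.≰⇒> λ bx≤x → ¬left (lose b∈A ((vertical , in-row) , bx≤x))))
... | _ | no ¬right = ⊥-elim (¬crosses (inj₂ λ b b∈A vertical in-row →
        ℤ.≮⇒≥ λ x<bx → ¬right (lose b∈A ((vertical , in-row) , x<bx))))
... | yes left | yes right with find left | find right
...   | b₁ , b₁∈A , in-row₁ , b₁≤x | b₂ , b₂∈A , in-row₂ , x<b₂ =
  subst (2 ≤_) (sym (countVRow≡count j A))
    (count-≥2 (verticalIn? j) b₁∈A b₂∈A (λ { refl → ℤ.<⇒≱ x<b₂ b₁≤x }) in-row₁ in-row₂)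

Linked⇒VerticalIn : ∀ {A u v j} → Linked A u v → proj₂ u ≤ℤ j → j <ℤ proj₂ v →
                    ∃ λ b → b ∈ A × VerticalIn j b
Linked⇒VerticalIn lrefl u≤j j<u = ⊥-elim (ℤ.<⇒≱ j<u u≤j)
Linked⇒VerticalIn (lfwd (bond H _ _) _ l) u≤j j<y = Linked⇒VerticalIn l u≤j j<y
Linked⇒VerticalIn {j = j} (lfwd (bond V x y) b∈A l) u≤j j<y+1 with ℤ.<-cmp j y
... | tri< j<y _ _  = Linked⇒VerticalIn l u≤j j<y
... | tri≈ _ refl _ = bond V x y , b∈A , refl , refl
... | tri> _ _ y<j  = ⊥-elim (ℤ.<⇒≱ j<y+1 (subst (_≤ℤ j) (ℤ.+-comm 1ℤ y) (ℤ.i<j⇒suc[i]≤j y<j)))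
Linked⇒VerticalIn (lbwd (bond H _ _) _ l) u≤j j<y = Linked⇒VerticalIn l u≤j j<y
Linked⇒VerticalIn (lbwd (bond V _ y) _ l) u≤j j<y =
  Linked⇒VerticalIn l u≤j (ℤ.<-trans j<y (subst (y <ℤ_) (ℤ.+-comm 1ℤ y) (ℤ.suc[i]≤j⇒i<j ℤ.≤-refl)))

SpansRow⇒1≤countVRow : ∀ {A j} → Connected A → SpansRow A j → 1 ≤ countVRow j A
SpansRow⇒1≤countVRow {A} {j} connected ((b , b∈A , b≤j) , (b′ , b′∈A , j+1≤b′))
  with Linked⇒VerticalIn (lfwd b′ b′∈A (connected b b′ b∈A b′∈A)) b≤j
         (ℤ.suc[i]≤j⇒i<j (subst (_≤ℤ _) (ℤ.+-comm j 1ℤ) j+1≤b′))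
... | c , c∈A , in-row = subst (1 ≤_) (sym (countVRow≡count j A)) (count-≥1 (verticalIn? j) c∈A in-row)

2m≤countV : ∀ j m A → (∀ {i} → i < m → 2 ≤ countVRow (j +ℤ + suc i) A) → m * 2 ≤ countV A
2m≤countV j m A 2≤row = begin
  m * 2                                   ≡⟨ ∑-const m 2 ⟨
  ∑[ i < m ] 2                            ≤⟨ ∑-mono-≤ m 2≤row ⟩
  ∑[ i < m ] countVRow (j +ℤ + suc i) A   ≤⟨ ∑countVRow≤countV j m A ⟩
  countV A                                ∎
  where open ℕ.≤-Reasoning

tight⇒countVRow≡2 : ∀ j m {A} → Connected A → (∀ {i} → i < m → 2 ≤ countVRow (j +ℤ + suc i) A) →
                    countV A ≤ m * 2 → ∀ j′ → SpansRow A j′ → countVRow j′ A ≡ 2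
tight⇒countVRow≡2 j m {A} connected 2≤row countV≤2m j′ spans with (j <? j′) ×-dec (j′ ≤? j +ℤ + m)
... | yes (j<j′ , j′≤j+m) with in-band⇒≡+suc m j<j′ j′≤j+m
...   | i , i<m , refl = sym (∑-mono-≤-tight m 2≤row ∑rows≤∑2 i<m)
  where
    ∑rows≤∑2 : ∑[ i < m ] countVRow (j +ℤ + suc i) A ≤ ∑[ i < m ] 2
    ∑rows≤∑2 = ℕ.≤-trans (∑countVRow≤countV j m A) (subst (countV A ≤_) (sym (∑-const m 2)) countV≤2m)
tight⇒countVRow≡2 j m {A} connected 2≤row countV≤2m j′ spans | no j′∉band =
  ⊥-elim (ℕ.m+1+n≰m _ (begin
    ∑[ i < m ] countVRow (j +ℤ + suc i) A + 1              ≤⟨ ℕ.+-monoʳ-≤ _ (SpansRow⇒1≤countVRow connected spans) ⟩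
    ∑[ i < m ] countVRow (j +ℤ + suc i) A + countVRow j′ A ≤⟨ ∑countVRow+countVRow≤countV j m A j′∉band ⟩
    countV A                                               ≤⟨ countV≤2m ⟩
    m * 2                                                  ≡⟨ ∑-const m 2 ⟨
    ∑[ i < m ] 2                                           ≤⟨ ∑-mono-≤ m 2≤row ⟩
    ∑[ i < m ] countVRow (j +ℤ + suc i) A                  ∎))
  where open ℕ.≤-Reasoning

m≤1+n⇒2*m∸2≤n*2 : ∀ {m n} → m ≤ suc n → 2 * m ∸ 2 ≤ n * 2
m≤1+n⇒2*m∸2≤n*2 {zero}        _         = z≤n
m≤1+n⇒2*m∸2≤n*2 {suc m} {n} (s≤s m≤n) = begin
  2 * suc m ∸ 2 ≡⟨ cong (_∸ 2) (ℕ.*-suc 2 m) ⟩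
  2 + 2 * m ∸ 2 ≡⟨ ℕ.m+n∸m≡n 2 (2 * m) ⟩
  2 * m         ≤⟨ ℕ.*-monoʳ-≤ 2 m≤n ⟩
  2 * n         ≡⟨ ℕ.*-comm 2 n ⟩
  n * 2         ∎
  where open ℕ.≤-Reasoning

mainTheorem5 : (A : List Bond) → Unique A → Connected A → Directed A →
    (k : ℕ) → 1 ≤ k → HasSection A k →
    (2 * k ∸ 2 ≤ countV A) ×
    (countV A ≡ 2 * k ∸ 2 → ∀ (j : ℤ) → SpansRow A j → countVRow j A ≡ 2)
mainTheorem5 A unique connected _ k _ (x , j₁ , j₂ , j₁<j₂ , _ , _ , between , countHCol≡k)
  with i<j⇒j≡i+suc j₁<j₂
... | m , refl =
  ℕ.≤-trans 2k∸2≤2m (2m≤countV j₁ m A 2≤row) ,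
  λ countV≡2k∸2 → tight⇒countVRow≡2 j₁ m connected 2≤row (subst (_≤ m * 2) (sym countV≡2k∸2) 2k∸2≤2m)
  where
    2≤row : ∀ {i} → i < m → 2 ≤ countVRow (j₁ +ℤ + suc i) A
    2≤row {i} i<m = ¬Crosses⇒2≤countVRow (between _ (i<i+suc j₁ i) (ℤ.+-monoʳ-< j₁ (+<+ (s≤s i<m))))

    2k∸2≤2m : 2 * k ∸ 2 ≤ m * 2
    2k∸2≤2m = m≤1+n⇒2*m∸2≤n*2 (subst (_≤ suc m) countHCol≡k (countHCol≤ x j₁ (suc m) unique))
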